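{- Let $n\ge1$ and let $K$ be a pure $n$-simplicial complex. (1) If $K$ has no $(n-1,n)$-simplicial cycle sequence, then $\alpha_{n-1}(K)\ge n\,\alpha_n(K)+1$. (2) If $K$ is connected, then $\alpha_{n-1}(K)\le n\,\alpha_n(K)+1$.
   Context: A simplicial complex on a finite vertex set is a collection of non-empty vertex subsets containing all singletons and closed under non-empty subsets; a $k$-simplex has $k+1$ vertices; $\tau$ is a face of $\sigma$ if $\tau\subseteq\sigma$; $\alpha_k(K)$ is the number of $k$-simplices. $K$ is a pure $n$-simplicial complex if $\dim K=n$ and every simplex is a face of some $n$-simplex. An $(n-1,n)$-walk sequence is an alternating sequence $\sigma_1,\eta_1,\sigma_2,\dots,\sigma_r,\eta_r,\sigma_{r+1}$ of $(n-1)$-simplices $\sigma_k$ and $n$-simplices $\eta_k$ with $\sigma_k\ne\sigma_{k+1}$ both faces of $\eta_k$; it is an $(n-1,n)$-path sequence if all its simplices are distinct. $K$ is connected if there is an $(n-1,n)$-path sequence between every pair of distinct $(n-1)$-simplices. An $(n-1,n)$-simplicial cycle sequence is an $(n-1,n)$-walk sequence with $\sigma_{r+1}=\sigma_1$, $\sigma_p\ne\sigma_q$ and $\eta_p\ne\eta_q$ for $1\le p\ne q\le r$, such that $r\ge3$, $\sigma_1$ is not a face of $\eta_k$ for $2\le k\le r-1$, and for each $2\le z\le r$ there is an $(n-1)$-simplex $\sigma'_z$ which is a face of $\eta_{z-1}$ and $\eta_z$ and has $\sigma_z$ as a face, with the $\sigma'_z$ pairwise distinct. -}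

module Defs where

open import Data.Bool using (Bool; true; false; T; _∧_)
open import Data.Nat using (ℕ; zero; suc; _≤_; _<_; _∸_; _≡ᵇ_)
open import Data.List using (List; []; _∷_; _++_; map)
open import Data.Vec using (_∷_; [])
open import Data.Fin using (Fin)
open import Data.Fin.Subset using (Subset; _⊆_; ∣_∣; Nonempty; ⁅_⁆; inside; outside)
open import Data.Product using (Σ; ∃; _×_)
open import Relation.Binary.PropositionalEquality using (_≡_; _≢_)
open import Relation.Nullary using (¬_)

record SimplicialComplex (m : ℕ) : Set where
  field
    simplex    : Subset m → Bool
    nonempty   : ∀ s → T (simplex s) → Nonempty s
    singletons : ∀ x → T (simplex ⁅ x ⁆)
    closed     : ∀ s t → T (simplex s) → Nonempty t → t ⊆ s → T (simplex t)
open SimplicialComplex public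

IsSimplex : ∀ {m} → SimplicialComplex m → ℕ → Subset m → Set
IsSimplex K k s = T (simplex K s) × ∣ s ∣ ≡ suc k

allSubsets : (m : ℕ) → List (Subset m)
allSubsets zero = [] ∷ []
allSubsets (suc m) = map (outside ∷_) (allSubsets m) ++ map (inside ∷_) (allSubsets m)

countB : ∀ {A : Set} → (A → Bool) → List A → ℕ
countB p [] = 0
countB p (x ∷ xs) with p x
... | true  = suc (countB p xs)
... | false = countB p xs

α : ∀ {m} → ℕ → SimplicialComplex m → ℕ
α {m} k K = countB (λ s → simplex K s ∧ (∣ s ∣ ≡ᵇ suc k)) (allSubsets m)

HasDim : ∀ {m} → SimplicialComplex m → ℕ → Set
HasDim {m} K n = (∃ λ (s : Subset m) → IsSimplex K n s)
               × (∀ s → T (simplex K s) → ∣ s ∣ ≤ suc n)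

IsPure : ∀ {m} → SimplicialComplex m → ℕ → Set
IsPure {m} K n = HasDim K n
               × (∀ s → T (simplex K s) → ∃ λ (t : Subset m) → IsSimplex K n t × s ⊆ t)

-- (n-1,n)-walk sequence σ_1, η_1, σ_2, …, σ_r, η_r, σ_{r+1}
-- (1-indexed; values of σ, η outside the index ranges are irrelevant)
IsWalk : ∀ {m} → SimplicialComplex m → (n r : ℕ) → (σ η : ℕ → Subset m) → Set
IsWalk K n r σ η =
    (∀ k → 1 ≤ k → k ≤ suc r → IsSimplex K (n ∸ 1) (σ k))
  × (∀ k → 1 ≤ k → k ≤ r →
       IsSimplex K n (η k) × σ k ≢ σ (suc k) × σ k ⊆ η k × σ (suc k) ⊆ η k)

IsPath : ∀ {m} → SimplicialComplex m → (n r : ℕ) → (σ η : ℕ → Subset m) → Set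
IsPath K n r σ η =
    IsWalk K n r σ η
  × (∀ p q → 1 ≤ p → p ≤ suc r → 1 ≤ q → q ≤ suc r → p ≢ q → σ p ≢ σ q)
  × (∀ p q → 1 ≤ p → p ≤ r → 1 ≤ q → q ≤ r → p ≢ q → η p ≢ η q)

IsConnected : ∀ {m} → SimplicialComplex m → ℕ → Set
IsConnected {m} K n =
  ∀ (τ τ' : Subset m) → IsSimplex K (n ∸ 1) τ → IsSimplex K (n ∸ 1) τ' → τ ≢ τ' →
    Σ ℕ λ r → Σ (ℕ → Subset m) λ σ → Σ (ℕ → Subset m) λ η →
      IsPath K n r σ η × σ 1 ≡ τ × σ (suc r) ≡ τ'

IsCycle : ∀ {m} → SimplicialComplex m → (n r : ℕ) → (σ η : ℕ → Subset m) → Set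
IsCycle {m} K n r σ η =
    IsWalk K n r σ η
  × σ (suc r) ≡ σ 1
  × (∀ p q → 1 ≤ p → p ≤ r → 1 ≤ q → q ≤ r → p ≢ q → σ p ≢ σ q)
  × (∀ p q → 1 ≤ p → p ≤ r → 1 ≤ q → q ≤ r → p ≢ q → η p ≢ η q)
  × 3 ≤ r
  × (∀ k → 2 ≤ k → k ≤ r ∸ 1 → ¬ (σ 1 ⊆ η k))
  × (Σ (ℕ → Subset m) λ σ' →
        (∀ z → 2 ≤ z → z ≤ r →
           IsSimplex K (n ∸ 1) (σ' z) × σ' z ⊆ η (z ∸ 1) × σ' z ⊆ η z × σ z ⊆ σ' z)
      × (∀ p q → 2 ≤ p → p ≤ r → 2 ≤ q → q ≤ r → p ≢ q → σ' p ≢ σ' q))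

HasCycle : ∀ {m} → SimplicialComplex m → ℕ → Set
HasCycle {m} K n = Σ ℕ λ r → Σ (ℕ → Subset m) λ σ → Σ (ℕ → Subset m) λ η → IsCycle K n r σ η

module Submission where

-- Process the n-simplices one at a time while maintaining a partition of the
-- (n−1)-simplices into classes, starting from singletons.  Adding an n-simplex η
-- merges the classes of its n + 1 faces, so the number of classes drops by at most n.
-- If K is connected, a single class remains at the end, whence α_{n−1} − n α_n ≤ 1.
-- If two faces of η already share a class, they are joined by a walk avoiding η;
-- shortcutting it to a path and closing it through η yields a cycle sequence.
-- So without cycle sequences every step drops exactly n classes, and since at least
-- one class survives, α_{n−1} − n α_n ≥ 1.

open import Defs
open import Data.Bool using (Bool; true; false; T; _∧_; _∨_; if_then_else_)
import Data.Bool.Properties as Bool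
open import Data.Bool.Properties using (T-∧; T?)
open import Data.Nat using (ℕ; zero; suc; _+_; _*_; _≤_; _<_; _∸_; _≡ᵇ_; z≤n; s≤s; _<?_)
open import Data.Nat.Properties
open import Data.Nat.Tactic.RingSolver using (solve-∀)
open import Algebra.Properties.CommutativeSemigroup +-commutativeSemigroup using (interchange)
open import Data.List using (List; []; _∷_; _++_; map; drop)
import Data.List as List
open import Data.Bool.ListAction using (any)
open import Data.List.Membership.Propositional using (_∈_; _∉_; find; lose)
open import Data.List.Membership.Propositional.Properties using (∈-map⁺; ∈-map⁻; ∈-++⁺ˡ; ∈-++⁺ʳ)
open import Data.List.Relation.Unary.Any using (Any; here; there)
open import Data.List.Relation.Unary.Any.Properties using (any⁺; any⁻)
open import Data.List.Relation.Unary.All as All using (All; []; _∷_)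
open import Data.List.Relation.Unary.All.Properties using (All¬⇒¬Any; drop⁺)
open import Data.List.Relation.Unary.AllPairs using ([]; _∷_)
open import Data.List.Relation.Unary.Unique.Propositional using (Unique)
import Data.List.Relation.Unary.Unique.Propositional.Properties as Unique
open import Data.Vec using (_∷_; [])
import Data.Vec as Vec
open import Data.Vec.Properties using (≡-dec; ∷-injectiveʳ)
open import Data.Fin.Subset using (Subset; _⊆_; ∣_∣; Nonempty; inside; outside; _∪_)
open import Data.Fin.Subset.Properties using (_⊆?_; p⊆q⇒∣p∣≤∣q∣; drop-∷-⊆; p⊆p∪q; q⊆p∪q; x∈p∪q⁻)
open import Data.Product using (Σ; ∃; _×_; _,_; proj₁; proj₂)
open import Data.Sum using (_⊎_; inj₁; inj₂; [_,_])
open import Data.Empty using (⊥-elim)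
open import Function using (id; _∘_; Equivalence)
import Data.Fin as Fin
open import Relation.Binary.Definitions using (DecidableEquality)
open import Relation.Binary.PropositionalEquality using (_≡_; _≢_; refl; sym; trans; cong; cong₂; subst; module ≡-Reasoning)
open import Relation.Nullary using (¬_; Dec; yes; no; does)
open import Relation.Nullary.Decidable using (⌊_⌋; toWitness; fromWitness; isYes≗does)

private variable A B : Set

𝟙[_] : Bool → ℕ
𝟙[ true ]  = 1
𝟙[ false ] = 0

T-∧⁺ : ∀ {a b} → T a → T b → T (a ∧ b)
T-∧⁺ ta tb = Equivalence.from T-∧ (ta , tb)

T-∧⁻ˡ : ∀ a {b} → T (a ∧ b) → T a
T-∧⁻ˡ a = proj₁ ∘ Equivalence.to (T-∧ {a})

T-∧⁻ʳ : ∀ a {b} → T (a ∧ b) → T b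
T-∧⁻ʳ a = proj₂ ∘ Equivalence.to (T-∧ {a})

if-T : ∀ {b} {x y : A} → T b → (if b then x else y) ≡ x
if-T {b = true} _ = refl

if-¬T : ∀ {b} {x y : A} → ¬ T b → (if b then x else y) ≡ y
if-¬T {b = true}  ¬t = ⊥-elim (¬t _)
if-¬T {b = false} _  = refl

𝟙-T : ∀ {b} → T b → 𝟙[ b ] ≡ 1
𝟙-T {true} _ = refl

𝟙-¬T : ∀ {b} → ¬ T b → 𝟙[ b ] ≡ 0
𝟙-¬T {true}  ¬t = ⊥-elim (¬t _)
𝟙-¬T {false} _  = refl

does⇒ : ∀ {P : Set} (d : Dec P) → T (does d) → P
does⇒ d h = toWitness (subst T (sym (isYes≗does d)) h)

⇒does : ∀ {P : Set} (d : Dec P) → P → T (does d)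
⇒does d p = subst T (isYes≗does d) (fromWitness p)

countB-cons : ∀ (p : A → Bool) x xs → countB p (x ∷ xs) ≡ 𝟙[ p x ] + countB p xs
countB-cons p x xs with p x
... | true  = refl
... | false = refl

countB-pointwise : ∀ (p q p′ q′ : A → Bool) xs →
  (∀ x → 𝟙[ p x ] + 𝟙[ q x ] ≡ 𝟙[ p′ x ] + 𝟙[ q′ x ]) →
  countB p xs + countB q xs ≡ countB p′ xs + countB q′ xs
countB-pointwise p q p′ q′ [] h = refl
countB-pointwise p q p′ q′ (x ∷ xs) h
  rewrite countB-cons p x xs | countB-cons q x xs | countB-cons p′ x xs | countB-cons q′ x xs
  = begin
    (𝟙[ p x ] + countB p xs) + (𝟙[ q x ] + countB q xs)   ≡⟨ interchange 𝟙[ p x ] _ _ _ ⟩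
    (𝟙[ p x ] + 𝟙[ q x ]) + (countB p xs + countB q xs)   ≡⟨ cong₂ _+_ (h x) (countB-pointwise p q p′ q′ xs h) ⟩
    (𝟙[ p′ x ] + 𝟙[ q′ x ]) + (countB p′ xs + countB q′ xs) ≡⟨ interchange 𝟙[ p′ x ] _ _ _ ⟩
    (𝟙[ p′ x ] + countB p′ xs) + (𝟙[ q′ x ] + countB q′ xs) ∎
  where open ≡-Reasoning

countB-∨-∧ : ∀ (p q : A → Bool) xs →
  countB (λ x → p x ∨ q x) xs + countB (λ x → p x ∧ q x) xs ≡ countB p xs + countB q xs
countB-∨-∧ p q xs = countB-pointwise _ _ p q xs λ x → lemma (p x) (q x)
  where
  lemma : ∀ a b → 𝟙[ a ∨ b ] + 𝟙[ a ∧ b ] ≡ 𝟙[ a ] + 𝟙[ b ]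
  lemma true  true  = refl
  lemma true  false = refl
  lemma false true  = refl
  lemma false false = refl

countB-cong : ∀ (p q : A → Bool) xs → (∀ x → p x ≡ q x) → countB p xs ≡ countB q xs
countB-cong p q [] h = refl
countB-cong p q (x ∷ xs) h
  rewrite countB-cons p x xs | countB-cons q x xs | h x = cong (𝟙[ q x ] +_) (countB-cong p q xs h)

countB-mono : ∀ (p q : A → Bool) xs → (∀ x → T (p x) → T (q x)) → countB p xs ≤ countB q xs
countB-mono p q [] h = z≤n
countB-mono p q (x ∷ xs) h
  rewrite countB-cons p x xs | countB-cons q x xs = +-mono-≤ (𝟙-mono (h x)) (countB-mono p q xs h)
  where
  𝟙-mono : ∀ {a b} → (T a → T b) → 𝟙[ a ] ≤ 𝟙[ b ]
  𝟙-mono {false}         _ = z≤n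
  𝟙-mono {true} {true}   _ = ≤-refl
  𝟙-mono {true} {false}  h = ⊥-elim (h _)

countB-none : ∀ (p : A → Bool) {xs} → All (λ x → ¬ T (p x)) xs → countB p xs ≡ 0
countB-none p [] = refl
countB-none p {x ∷ xs} (¬px ∷ h) with p x
... | true  = ⊥-elim (¬px _)
... | false = countB-none p h

countB-++ : ∀ (p : A → Bool) xs ys → countB p (xs ++ ys) ≡ countB p xs + countB p ys
countB-++ p [] ys = refl
countB-++ p (x ∷ xs) ys
  rewrite countB-cons p x (xs ++ ys) | countB-cons p x xs | countB-++ p xs ys = sym (+-assoc 𝟙[ p x ] _ _)

countB-map : ∀ (p : B → Bool) (f : A → B) xs → countB p (map f xs) ≡ countB (p ∘ f) xs
countB-map p f [] = refl
countB-map p f (x ∷ xs)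
  rewrite countB-cons p (f x) (map f xs) | countB-cons (p ∘ f) x xs | countB-map p f xs = refl

countB-witness : ∀ (p : A → Bool) xs → 0 < countB p xs → ∃ λ x → x ∈ xs × T (p x)
countB-witness p (x ∷ xs) h with p x in eq
... | true  = x , here refl , subst T (sym eq) _
... | false with countB-witness p xs h
...   | y , y∈xs , py = y , there y∈xs , py

countB-≥1 : ∀ (p : A → Bool) {x xs} → x ∈ xs → T (p x) → 1 ≤ countB p xs
countB-≥1 p {xs = y ∷ xs} (here refl) px rewrite countB-cons p y xs with p y
... | true = s≤s z≤n
countB-≥1 p {xs = y ∷ xs} (there x∈xs) px rewrite countB-cons p y xs =
  ≤-trans (countB-≥1 p x∈xs px) (m≤n+m _ 𝟙[ p y ])

countB-false : ∀ (xs : List A) → countB (λ _ → false) xs ≡ 0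
countB-false xs = countB-none (λ _ → false) {xs} (All.tabulate λ _ ())

module FiniteCounting {A : Set} (_≟_ : DecidableEquality A) (U : List A)
                      (U-unique : Unique U) (U-complete : ∀ x → x ∈ U) where

  count-≟ : ∀ c → countB (λ x → ⌊ c ≟ x ⌋) U ≡ 1
  count-≟ c = go U-unique (U-complete c)
    where
    go : ∀ {xs} → Unique xs → c ∈ xs → countB (λ x → ⌊ c ≟ x ⌋) xs ≡ 1
    go {y ∷ xs} (y∉xs ∷ u) c∈ with c ≟ y | c∈
    ... | yes refl | _          = cong suc (countB-none _ (All.map (λ c≢x → c≢x ∘ toWitness) y∉xs))
    ... | no  c≢y  | here c≡y   = ⊥-elim (c≢y c≡y)
    ... | no  _    | there c∈xs = go u c∈xs

  count-≤1 : ∀ (p : A → Bool) → (∀ x y → T (p x) → T (p y) → x ≡ y) → countB p U ≤ 1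
  count-≤1 p at-most-one with 0 <? countB p U
  ... | no ¬pos = ≤-trans (≮⇒≥ ¬pos) z≤n
  ... | yes pos with countB-witness p U pos
  ...   | c , _ , pc = begin
    countB p U                   ≤⟨ countB-mono p _ U (λ x px → fromWitness (at-most-one c x pc px)) ⟩
    countB (λ x → ⌊ c ≟ x ⌋) U  ≡⟨ count-≟ c ⟩
    1                            ∎
    where open ≤-Reasoning

  IsImage : (A → Bool) → (A → A) → List A → A → Bool
  IsImage p g L y = any (λ x → p x ∧ ⌊ g x ≟ y ⌋) L

  IsImage-sound : ∀ {p : A → Bool} {g : A → A} {L y} → T (IsImage p g L y) →
    ∃ λ x → x ∈ L × T (p x) × g x ≡ y
  IsImage-sound {L = L} h with find (any⁻ _ L h)
  ... | x , x∈L , t = let px , gx≡y = Equivalence.to T-∧ t in x , x∈L , px , toWitness gx≡y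

  IsImage-complete : ∀ {p : A → Bool} {g : A → A} {L x} → x ∈ L → T (p x) → T (IsImage p g L (g x))
  IsImage-complete {g = g} {x = x} x∈L px =
    any⁺ _ (lose x∈L (T-∧⁺ px (fromWitness {a? = g x ≟ g x} refl)))

  private
    count-singleton : ∀ (p : A → Bool) (g : A → A) x →
      countB (λ y → p x ∧ ⌊ g x ≟ y ⌋) U ≡ 𝟙[ p x ]
    count-singleton p g x with p x
    ... | true  = count-≟ (g x)
    ... | false = countB-false U

    count-image-cons : ∀ (p : A → Bool) (g : A → A) x L →
      countB (IsImage p g (x ∷ L)) U + countB (λ y → (p x ∧ ⌊ g x ≟ y ⌋) ∧ IsImage p g L y) U
        ≡ 𝟙[ p x ] + countB (IsImage p g L) U
    count-image-cons p g x L =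
      trans (countB-∨-∧ (λ y → p x ∧ ⌊ g x ≟ y ⌋) (IsImage p g L) U)
            (cong (_+ countB (IsImage p g L) U) (count-singleton p g x))

  count-image≤ : ∀ (p : A → Bool) (g : A → A) L → countB (IsImage p g L) U ≤ countB p L
  count-image≤ p g []      = ≤-reflexive (countB-false U)
  count-image≤ p g (x ∷ L) = begin
    countB (IsImage p g (x ∷ L)) U         ≤⟨ m≤m+n _ _ ⟩
    countB (IsImage p g (x ∷ L)) U + _     ≡⟨ count-image-cons p g x L ⟩
    𝟙[ p x ] + countB (IsImage p g L) U    ≤⟨ +-monoʳ-≤ 𝟙[ p x ] (count-image≤ p g L) ⟩
    𝟙[ p x ] + countB p L                  ≡⟨ countB-cons p x L ⟨
    countB p (x ∷ L)                       ∎
    where open ≤-Reasoning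

  count-image≡ : ∀ (p : A → Bool) (g : A → A) L → Unique L →
    (∀ {x x′} → x ∈ L → x′ ∈ L → T (p x) → T (p x′) → g x ≡ g x′ → x ≡ x′) →
    countB (IsImage p g L) U ≡ countB p L
  count-image≡ p g []      _            _   = countB-false U
  count-image≡ p g (x ∷ L) (x∉L ∷ uniq) inj = begin
    countB (IsImage p g (x ∷ L)) U         ≡⟨ +-identityʳ _ ⟨
    countB (IsImage p g (x ∷ L)) U + 0     ≡⟨ cong (countB (IsImage p g (x ∷ L)) U +_) no-overlap ⟨
    countB (IsImage p g (x ∷ L)) U + _     ≡⟨ count-image-cons p g x L ⟩
    𝟙[ p x ] + countB (IsImage p g L) U    ≡⟨ cong (𝟙[ p x ] +_) (count-image≡ p g L uniq (λ a b → inj (there a) (there b))) ⟩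
    𝟙[ p x ] + countB p L                  ≡⟨ countB-cons p x L ⟨
    countB p (x ∷ L)                       ∎
    where
    open ≡-Reasoning
    no-overlap : countB (λ y → (p x ∧ ⌊ g x ≟ y ⌋) ∧ IsImage p g L y) U ≡ 0
    no-overlap = countB-none _ {U} (All.tabulate λ _ h →
      let x-hit , L-hit = Equivalence.to T-∧ h
          px , gx≡y     = Equivalence.to T-∧ x-hit
          x′ , x′∈L , px′ , gx′≡y = IsImage-sound L-hit
      in All.lookup x∉L (subst (_∈ L) (inj (there x′∈L) (here refl) px′ px
           (trans gx′≡y (sym (toWitness gx≡y)))) x′∈L) refl)

firstWith : (A → Bool) → A → List A → A
firstWith p d []       = d
firstWith p d (x ∷ xs) = if p x then x else firstWith p d xs

firstWith-satisfies : ∀ (p : A → Bool) d {xs y} → y ∈ xs → T (p y) → T (p (firstWith p d xs))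
firstWith-satisfies p d {x ∷ xs} y∈ py with p x in eq
... | true = subst T (sym eq) _
... | false with y∈
...   | here refl  = ⊥-elim (subst T eq py)
...   | there y∈xs = firstWith-satisfies p d y∈xs py

nthOr : A → List A → ℕ → A
nthOr d []       _       = d
nthOr d (x ∷ xs) zero    = x
nthOr d (x ∷ xs) (suc i) = nthOr d xs i

nthOr-∈ : ∀ (d : A) xs {i} → i < List.length xs → nthOr d xs i ∈ xs
nthOr-∈ d (x ∷ xs) {zero}  _         = here refl
nthOr-∈ d (x ∷ xs) {suc i} (s≤s i<) = there (nthOr-∈ d xs i<)

nthOr-All : ∀ {P : A → Set} {d xs} → P d → All P xs → ∀ i → P (nthOr d xs i)
nthOr-All pd []         _       = pd
nthOr-All pd (px ∷ _)   zero    = px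
nthOr-All pd (_ ∷ pxs) (suc i) = nthOr-All pd pxs i

nthOr-beyond : ∀ (d : A) xs {i} → List.length xs ≤ i → nthOr d xs i ≡ d
nthOr-beyond d []       _         = refl
nthOr-beyond d (x ∷ xs) (s≤s len≤) = nthOr-beyond d xs len≤

nthOr-injective : ∀ (d : A) {xs} → Unique xs → ∀ {i j} → i < List.length xs → j < List.length xs →
                  nthOr d xs i ≡ nthOr d xs j → i ≡ j
nthOr-injective d {x ∷ xs} _ {zero} {zero} _ _ _ = refl
nthOr-injective d {x ∷ xs} (x∉xs ∷ _) {zero} {suc j} _ (s≤s j<) x≡ =
  ⊥-elim (All.lookup x∉xs (nthOr-∈ d xs j<) x≡)
nthOr-injective d {x ∷ xs} (x∉xs ∷ _) {suc i} {zero} (s≤s i<) _ ≡x =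
  ⊥-elim (All.lookup x∉xs (nthOr-∈ d xs i<) (sym ≡x))
nthOr-injective d {x ∷ xs} (_ ∷ u) {suc i} {suc j} (s≤s i<) (s≤s j<) eq =
  cong suc (nthOr-injective d u i< j< eq)

nthOr-injective-default : ∀ (d : A) {xs} → Unique xs → d ∉ xs → ∀ {i j} →
  i ≤ List.length xs → j ≤ List.length xs → nthOr d xs i ≡ nthOr d xs j → i ≡ j
nthOr-injective-default d {xs} u d∉xs {i} {j} i≤ j≤ eq with m≤n⇒m<n∨m≡n i≤ | m≤n⇒m<n∨m≡n j≤
... | inj₁ i< | inj₁ j< = nthOr-injective d u i< j< eq
... | inj₁ i< | inj₂ refl =
  ⊥-elim (d∉xs (subst (_∈ xs) (trans eq (nthOr-beyond d xs ≤-refl)) (nthOr-∈ d xs i<)))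
... | inj₂ refl | inj₁ j< =
  ⊥-elim (d∉xs (subst (_∈ xs) (trans (sym eq) (nthOr-beyond d xs ≤-refl)) (nthOr-∈ d xs j<)))
... | inj₂ refl | inj₂ refl = refl

_≟ₛ_ : ∀ {m} → DecidableEquality (Subset m)
_≟ₛ_ = ≡-dec Bool._≟_

allSubsets-complete : ∀ {m} (s : Subset m) → s ∈ allSubsets m
allSubsets-complete []                = here refl
allSubsets-complete {suc m} (outside ∷ s) = ∈-++⁺ˡ (∈-map⁺ (outside ∷_) (allSubsets-complete s))
allSubsets-complete {suc m} (inside ∷ s)  =
  ∈-++⁺ʳ (map (outside ∷_) (allSubsets m)) (∈-map⁺ (inside ∷_) (allSubsets-complete s))

allSubsets-unique : ∀ m → Unique (allSubsets m)
allSubsets-unique zero    = [] ∷ []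
allSubsets-unique (suc m) =
  Unique.++⁺ (Unique.map⁺ ∷-injectiveʳ (allSubsets-unique m))
             (Unique.map⁺ ∷-injectiveʳ (allSubsets-unique m)) disjoint
  where
  disjoint : ∀ {s} → ¬ (s ∈ map (outside ∷_) (allSubsets m) × s ∈ map (inside ∷_) (allSubsets m))
  disjoint (p , q) with ∈-map⁻ (outside ∷_) p | ∈-map⁻ (inside ∷_) q
  ... | _ , _ , refl | _ , _ , ()

module SubsetCounting (m : ℕ) =
  FiniteCounting (_≟ₛ_ {m}) (allSubsets m) (allSubsets-unique m) allSubsets-complete

#subsetsOfSize : ∀ {m} → ℕ → Subset m → ℕ
#subsetsOfSize {m} k t = countB (λ y → does (y ⊆? t) ∧ (∣ y ∣ ≡ᵇ k)) (allSubsets m)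

#subsetsOfSize-∷ : ∀ {m} k b (t : Subset m) → #subsetsOfSize k (b ∷ t) ≡
  #subsetsOfSize k t + countB (λ y → does ((inside ∷ y) ⊆? (b ∷ t)) ∧ (suc ∣ y ∣ ≡ᵇ k)) (allSubsets m)
#subsetsOfSize-∷ {m} k b t
  rewrite countB-++ (λ y → does (y ⊆? (b ∷ t)) ∧ (∣ y ∣ ≡ᵇ k)) (map (outside ∷_) (allSubsets m)) (map (inside ∷_) (allSubsets m))
        | countB-map (λ y → does (y ⊆? (b ∷ t)) ∧ (∣ y ∣ ≡ᵇ k)) (outside ∷_) (allSubsets m)
        | countB-map (λ y → does (y ⊆? (b ∷ t)) ∧ (∣ y ∣ ≡ᵇ k)) (inside ∷_) (allSubsets m) = refl

#subsetsOfSize-outside : ∀ {m} k (t : Subset m) → #subsetsOfSize k (outside ∷ t) ≡ #subsetsOfSize k t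
#subsetsOfSize-outside {m} k t =
  trans (#subsetsOfSize-∷ k outside t)
        (trans (cong (#subsetsOfSize k t +_) (countB-false (allSubsets m))) (+-identityʳ _))

#subsetsOfSize-inside-zero : ∀ {m} (t : Subset m) → #subsetsOfSize 0 (inside ∷ t) ≡ #subsetsOfSize 0 t
#subsetsOfSize-inside-zero {m} t =
  trans (#subsetsOfSize-∷ 0 inside t)
        (trans (cong (#subsetsOfSize 0 t +_) (countB-none _ {allSubsets m} (All.tabulate λ {y} _ → T-∧⁻ʳ (does (y ⊆? t)))))
               (+-identityʳ _))

#subsetsOfSize-inside : ∀ {m} k (t : Subset m) →
  #subsetsOfSize (suc k) (inside ∷ t) ≡ #subsetsOfSize (suc k) t + #subsetsOfSize k t
#subsetsOfSize-inside k t = #subsetsOfSize-∷ (suc k) inside t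

#subsetsOfSize-large : ∀ {m} k (t : Subset m) → ∣ t ∣ < k → #subsetsOfSize k t ≡ 0
#subsetsOfSize-large (suc k) []            _       = refl
#subsetsOfSize-large k       (outside ∷ t) ∣t∣<k   =
  trans (#subsetsOfSize-outside k t) (#subsetsOfSize-large k t ∣t∣<k)
#subsetsOfSize-large (suc k) (inside ∷ t) (s≤s ∣t∣<k) =
  trans (#subsetsOfSize-inside k t)
        (cong₂ _+_ (#subsetsOfSize-large (suc k) t (m≤n⇒m≤1+n ∣t∣<k)) (#subsetsOfSize-large k t ∣t∣<k))

#subsetsOfSize-self : ∀ {m} (t : Subset m) → #subsetsOfSize ∣ t ∣ t ≡ 1
#subsetsOfSize-self []            = refl
#subsetsOfSize-self (outside ∷ t) = trans (#subsetsOfSize-outside ∣ t ∣ t) (#subsetsOfSize-self t)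
#subsetsOfSize-self (inside ∷ t)  =
  trans (#subsetsOfSize-inside ∣ t ∣ t)
        (cong₂ _+_ (#subsetsOfSize-large (suc ∣ t ∣) t ≤-refl) (#subsetsOfSize-self t))

#subsetsOfSize-codim₁ : ∀ {m} k (t : Subset m) → ∣ t ∣ ≡ suc k → #subsetsOfSize k t ≡ suc k
#subsetsOfSize-codim₁ k (outside ∷ t) ∣t∣≡1+k =
  trans (#subsetsOfSize-outside k t) (#subsetsOfSize-codim₁ k t ∣t∣≡1+k)
#subsetsOfSize-codim₁ zero (inside ∷ t) ∣t∣≡1 =
  trans (#subsetsOfSize-inside-zero t)
        (subst (λ j → #subsetsOfSize j t ≡ 1) (suc-injective ∣t∣≡1) (#subsetsOfSize-self t))
#subsetsOfSize-codim₁ (suc k) (inside ∷ t) ∣t∣≡2+k =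
  trans (#subsetsOfSize-inside k t)
        (cong₂ _+_ (subst (λ j → #subsetsOfSize j t ≡ 1) (suc-injective ∣t∣≡2+k) (#subsetsOfSize-self t))
                   (#subsetsOfSize-codim₁ k t (suc-injective ∣t∣≡2+k)))

∣p∣≡suc⇒nonempty : ∀ {m} (p : Subset m) {k} → ∣ p ∣ ≡ suc k → Nonempty p
∣p∣≡suc⇒nonempty (inside  ∷ p) _ = Fin.zero , Vec.here
∣p∣≡suc⇒nonempty (outside ∷ p) h with ∣p∣≡suc⇒nonempty p h
... | x , x∈p = Fin.suc x , Vec.there x∈p

⊆∧∣≡∣⇒≡ : ∀ {m} {p q : Subset m} → p ⊆ q → ∣ p ∣ ≡ ∣ q ∣ → p ≡ q
⊆∧∣≡∣⇒≡ {p = []}          {[]}          _   _ = refl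
⊆∧∣≡∣⇒≡ {p = outside ∷ p} {outside ∷ q} p⊆q e = cong (outside ∷_) (⊆∧∣≡∣⇒≡ (drop-∷-⊆ p⊆q) e)
⊆∧∣≡∣⇒≡ {p = inside  ∷ p} {inside  ∷ q} p⊆q e =
  cong (inside ∷_) (⊆∧∣≡∣⇒≡ (drop-∷-⊆ p⊆q) (suc-injective e))
⊆∧∣≡∣⇒≡ {p = inside  ∷ p} {outside ∷ q} p⊆q e with p⊆q Vec.here
... | ()
⊆∧∣≡∣⇒≡ {p = outside ∷ p} {inside  ∷ q} p⊆q e =
  ⊥-elim (<-irrefl e (s≤s (p⊆q⇒∣p∣≤∣q∣ (drop-∷-⊆ p⊆q))))

∪-least : ∀ {m} {p q r : Subset m} → p ⊆ r → q ⊆ r → p ∪ q ⊆ r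
∪-least {p = p} {q} p⊆r q⊆r x∈p∪q with x∈p∪q⁻ p q x∈p∪q
... | inj₁ x∈p = p⊆r x∈p
... | inj₂ x∈q = q⊆r x∈q

-- Both supersets equal the union of the two subsets, which already has k + 2 elements.
unique-common-superset : ∀ {m} k {p q e e′ : Subset m} → p ≢ q →
  ∣ p ∣ ≡ suc k → ∣ q ∣ ≡ suc k → ∣ e ∣ ≡ suc (suc k) → ∣ e′ ∣ ≡ suc (suc k) →
  p ⊆ e → q ⊆ e → p ⊆ e′ → q ⊆ e′ → e ≡ e′
unique-common-superset k {p} {q} {e} {e′} p≢q ∣p∣ ∣q∣ ∣e∣ ∣e′∣ p⊆e q⊆e p⊆e′ q⊆e′ =
  trans (sym (union≡ (∪-least p⊆e q⊆e) ∣e∣)) (union≡ (∪-least p⊆e′ q⊆e′) ∣e′∣)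
  where
  p<p∪q : ∣ p ∣ < ∣ p ∪ q ∣
  p<p∪q = ≤∧≢⇒< (p⊆q⇒∣p∣≤∣q∣ (p⊆p∪q {p = p} q)) λ same →
    let p≡p∪q = ⊆∧∣≡∣⇒≡ (p⊆p∪q {p = p} q) same
    in p≢q (sym (⊆∧∣≡∣⇒≡ (subst (q ⊆_) (sym p≡p∪q) (q⊆p∪q p q)) (trans ∣q∣ (sym ∣p∣))))
  union≡ : ∀ {s} → p ∪ q ⊆ s → ∣ s ∣ ≡ suc (suc k) → p ∪ q ≡ s
  union≡ p∪q⊆s ∣s∣ = ⊆∧∣≡∣⇒≡ p∪q⊆s
    (≤-antisym (p⊆q⇒∣p∣≤∣q∣ p∪q⊆s) (subst (_≤ ∣ p ∪ q ∣) (trans (cong suc ∣p∣) (sym ∣s∣)) p<p∪q))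

isSimplexᵇ : ∀ {m} → SimplicialComplex m → ℕ → Subset m → Bool
isSimplexᵇ K k s = simplex K s ∧ (∣ s ∣ ≡ᵇ suc k)

isSimplexᵇ⇒IsSimplex : ∀ {m} {K : SimplicialComplex m} {k s} → T (isSimplexᵇ K k s) → IsSimplex K k s
isSimplexᵇ⇒IsSimplex {s = s} h = let s∈K , size = Equivalence.to T-∧ h in s∈K , ≡ᵇ⇒≡ ∣ s ∣ _ size

IsSimplex⇒isSimplexᵇ : ∀ {m} {K : SimplicialComplex m} {k s} → IsSimplex K k s → T (isSimplexᵇ K k s)
IsSimplex⇒isSimplexᵇ {s = s} (s∈K , size) = T-∧⁺ s∈K (≡⇒≡ᵇ ∣ s ∣ _ size)

-- Ridges and facets are the paper's (n − 1)- and n-simplices, the paper's n being suc n here.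
module Complex {m} (K : SimplicialComplex m) (n : ℕ) where

  Faces : List (Subset m)
  Faces = allSubsets m

  open SubsetCounting m public

  isRidge isFacet : Subset m → Bool
  isRidge = isSimplexᵇ K n
  isFacet = isSimplexᵇ K (suc n)

  ridge⇒IsSimplex : ∀ {σ} → T (isRidge σ) → IsSimplex K n σ
  ridge⇒IsSimplex = isSimplexᵇ⇒IsSimplex {K = K}

  facet⇒IsSimplex : ∀ {η} → T (isFacet η) → IsSimplex K (suc n) η
  facet⇒IsSimplex = isSimplexᵇ⇒IsSimplex {K = K}

  IsSimplex⇒ridge : ∀ {σ} → IsSimplex K n σ → T (isRidge σ)
  IsSimplex⇒ridge = IsSimplex⇒isSimplexᵇ {K = K}

  IsSimplex⇒facet : ∀ {η} → IsSimplex K (suc n) η → T (isFacet η)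
  IsSimplex⇒facet = IsSimplex⇒isSimplexᵇ {K = K}

  isRidgeOf : Subset m → Subset m → Bool
  isRidgeOf η σ = isRidge σ ∧ does (σ ⊆? η)

  isRidgeOf⇒isRidge : ∀ {η σ} → T (isRidgeOf η σ) → T (isRidge σ)
  isRidgeOf⇒isRidge {σ = σ} = T-∧⁻ˡ (isRidge σ)

  isRidgeOf⇒⊆ : ∀ {η σ} → T (isRidgeOf η σ) → σ ⊆ η
  isRidgeOf⇒⊆ {η} {σ} = does⇒ (σ ⊆? η) ∘ T-∧⁻ʳ (isRidge σ)

  isRidgeOf-intro : ∀ {η σ} → T (isRidge σ) → σ ⊆ η → T (isRidgeOf η σ)
  isRidgeOf-intro {η} {σ} σ-ridge σ⊆η = T-∧⁺ σ-ridge (⇒does (σ ⊆? η) σ⊆η)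

  #ridgesOf-facet : ∀ {η} → T (isFacet η) → countB (isRidgeOf η) Faces ≡ suc (suc n)
  #ridgesOf-facet {η} η-facet = trans (≤-antisym (countB-mono _ _ Faces ridge⇒subset)
                                                  (countB-mono _ _ Faces subset⇒ridge))
                                      (#subsetsOfSize-codim₁ (suc n) η ∣η∣)
    where
    η∈K : T (simplex K η)
    η∈K = proj₁ (facet⇒IsSimplex η-facet)
    ∣η∣ : ∣ η ∣ ≡ suc (suc n)
    ∣η∣ = proj₂ (facet⇒IsSimplex η-facet)
    ridge⇒subset : ∀ σ → T (isRidgeOf η σ) → T (does (σ ⊆? η) ∧ (∣ σ ∣ ≡ᵇ suc n))
    ridge⇒subset σ h = T-∧⁺ (T-∧⁻ʳ (isRidge σ) h) (T-∧⁻ʳ (simplex K σ) (T-∧⁻ˡ (isRidge σ) h))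
    subset⇒ridge : ∀ σ → T (does (σ ⊆? η) ∧ (∣ σ ∣ ≡ᵇ suc n)) → T (isRidgeOf η σ)
    subset⇒ridge σ h = isRidgeOf-intro (T-∧⁺ σ∈K size) σ⊆η
      where
      σ⊆η = does⇒ (σ ⊆? η) (T-∧⁻ˡ (does (σ ⊆? η)) h)
      size = T-∧⁻ʳ (does (σ ⊆? η)) h
      σ∈K = closed K η σ η∈K (∣p∣≡suc⇒nonempty σ (≡ᵇ⇒≡ ∣ σ ∣ (suc n) size)) σ⊆η

  -- Walks and cycle sequences

  module Walks (Allowed : Subset m → Set) where

    data Walk : Subset m → Subset m → Set where
      stop : ∀ {σ} → T (isRidge σ) → Walk σ σ
      step : ∀ {σ σ′ τ} η → Allowed η → T (isFacet η) → T (isRidge σ) →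
             σ ⊆ η → σ′ ⊆ η → σ ≢ σ′ → Walk σ′ τ → Walk σ τ

    ridges : ∀ {σ τ} → Walk σ τ → List (Subset m)
    ridges {σ} (stop _) = σ ∷ []
    ridges {σ} (step _ _ _ _ _ _ _ w) = σ ∷ ridges w

    facets : ∀ {σ τ} → Walk σ τ → List (Subset m)
    facets (stop _) = []
    facets (step η _ _ _ _ _ _ w) = η ∷ facets w

    steps : ∀ {σ τ} → Walk σ τ → ℕ
    steps (stop _)               = 0
    steps (step _ _ _ _ _ _ _ w) = suc (steps w)

    length-ridges : ∀ {σ τ} (w : Walk σ τ) → List.length (ridges w) ≡ suc (steps w)
    length-ridges (stop _)               = refl
    length-ridges (step _ _ _ _ _ _ _ w) = cong suc (length-ridges w)

    length-facets : ∀ {σ τ} (w : Walk σ τ) → List.length (facets w) ≡ steps w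
    length-facets (stop _)               = refl
    length-facets (step _ _ _ _ _ _ _ w) = cong suc (length-facets w)

    _++ᵂ_ : ∀ {σ σ′ τ} → Walk σ σ′ → Walk σ′ τ → Walk σ τ
    (stop _) ++ᵂ w′ = w′
    step η a f r s s′ d w ++ᵂ w′ = step η a f r s s′ d (w ++ᵂ w′)

    ridges-head : ∀ {σ τ} (w : Walk σ τ) d → nthOr d (ridges w) 0 ≡ σ
    ridges-head (stop _)               _ = refl
    ridges-head (step _ _ _ _ _ _ _ _) _ = refl

    ridges-isRidge : ∀ {σ τ} (w : Walk σ τ) → All (T ∘ isRidge) (ridges w)
    ridges-isRidge (stop σ-ridge)               = σ-ridge ∷ []
    ridges-isRidge (step _ _ _ σ-ridge _ _ _ w) = σ-ridge ∷ ridges-isRidge w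

    facets-allowed : ∀ {σ τ} (w : Walk σ τ) {η} → η ∈ facets w → Allowed η
    facets-allowed (step _ a _ _ _ _ _ _) (here refl) = a
    facets-allowed (step _ _ _ _ _ _ _ w) (there η∈) = facets-allowed w η∈

    ridges-covered : ∀ {σ τ} (w : Walk σ τ) {ρ} → ρ ∈ ridges w → ρ ≡ σ ⊎ Any (ρ ⊆_) (facets w)
    ridges-covered (stop _) (here refl) = inj₁ refl
    ridges-covered (step _ _ _ _ _ _ _ _) (here refl) = inj₁ refl
    ridges-covered (step _ _ _ _ _ σ′⊆η _ w) (there ρ∈) with ridges-covered w ρ∈
    ... | inj₁ refl = inj₂ (here σ′⊆η)
    ... | inj₂ ρ⊆ = inj₂ (there ρ⊆)

    IsSimple : ∀ {σ τ} → Walk σ τ → Set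
    IsSimple w = Unique (ridges w) × Unique (facets w)

    AvoidsStart : ∀ {σ τ} → Walk σ τ → Set
    AvoidsStart {σ} w = All (λ η → ¬ σ ⊆ η) (drop 1 (facets w))

    SimpleWalk : Subset m → Subset m → Set
    SimpleWalk σ τ = Σ (Walk σ τ) λ w → IsSimple w × AvoidsStart w

    private
      fresh-ridge : ∀ {σ σ′ τ} (w : Walk σ′ τ) → σ ≢ σ′ → All (λ η → ¬ σ ⊆ η) (facets w) →
                    All (σ ≢_) (ridges w)
      fresh-ridge w σ≢σ′ avoid = All.tabulate λ ρ∈ σ≡ρ →
        [ (λ ρ≡σ′ → σ≢σ′ (trans σ≡ρ ρ≡σ′))
        , (λ ρ⊆ → All¬⇒¬Any avoid (subst (λ x → Any (x ⊆_) (facets w)) (sym σ≡ρ) ρ⊆)) ]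
        (ridges-covered w ρ∈)

      fresh-facet : ∀ {σ σ′ τ η} (w : Walk σ′ τ) → σ ⊆ η → All (λ η → ¬ σ ⊆ η) (facets w) →
                    All (η ≢_) (facets w)
      fresh-facet w σ⊆η avoid = All.tabulate λ η′∈ η≡η′ → All.lookup avoid η′∈ (subst (_ ⊆_) η≡η′ σ⊆η)

    -- Either σ lies in no facet of w, or w can be cut right after its last facet containing σ.
    reroute : ∀ {σ′ τ} σ → T (isRidge σ) → (w : Walk σ′ τ) → IsSimple w →
              SimpleWalk σ τ ⊎ All (λ η → ¬ σ ⊆ η) (facets w)
    reroute σ σ-ridge (stop _) _ = inj₂ []
    reroute σ σ-ridge (step {σ′ = ρ} η a f _ _ ρ⊆η _ w) (_ ∷ ridges-uniq , _ ∷ facets-uniq)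
      with reroute σ σ-ridge w (ridges-uniq , facets-uniq)
    ... | inj₁ found = inj₁ found
    ... | inj₂ avoid with σ ⊆? η
    ...   | no σ⊈η = inj₂ (σ⊈η ∷ avoid)
    ...   | yes σ⊆η with σ ≟ₛ ρ
    ...     | yes refl = inj₁ (w , (ridges-uniq , facets-uniq) , drop⁺ 1 avoid)
    ...     | no σ≢ρ  = inj₁ (step η a f σ-ridge σ⊆η ρ⊆η σ≢ρ w ,
                              (fresh-ridge w σ≢ρ avoid ∷ ridges-uniq , fresh-facet w σ⊆η avoid ∷ facets-uniq) ,
                              avoid)

    simplify : ∀ {σ τ} → Walk σ τ → SimpleWalk σ τ
    simplify (stop σ-ridge) = stop σ-ridge , ([] ∷ [] , []) , []
    simplify (step η a f σ-ridge σ⊆η σ′⊆η σ≢σ′ w) with simplify w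
    ... | w′ , (ridges-uniq , facets-uniq) , _ with reroute _ σ-ridge w′ (ridges-uniq , facets-uniq)
    ...   | inj₁ found = found
    ...   | inj₂ avoid = step η a f σ-ridge σ⊆η σ′⊆η σ≢σ′ w′ ,
                         (fresh-ridge w′ σ≢σ′ avoid ∷ ridges-uniq , fresh-facet w′ σ⊆η avoid ∷ facets-uniq) ,
                         avoid

    -- 1-indexed with junk at 0; past the end of w they continue with ρ and η,
    -- which encodes the closing step τ, η, ρ of IsWalk-closing.
    ridgeSeq : ∀ {σ τ} → Subset m → Walk σ τ → ℕ → Subset m
    ridgeSeq ρ w = nthOr ρ (ρ ∷ ridges w)

    facetSeq : ∀ {σ τ} → Subset m → Walk σ τ → ℕ → Subset m
    facetSeq η w = nthOr η (η ∷ facets w)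

    IsWalk-closing : ∀ {σ τ ρ η} (w : Walk σ τ) → T (isRidge ρ) → T (isFacet η) →
      τ ⊆ η → ρ ⊆ η → τ ≢ ρ → IsWalk K (suc n) (suc (steps w)) (ridgeSeq ρ w) (facetSeq η w)
    IsWalk-closing {ρ = ρ} {η} w ρ-ridge η-facet τ⊆η ρ⊆η τ≢ρ =
      (λ k _ _ → ridge⇒IsSimplex (all-ridges k)) , stepAt w
      where
      all-ridges : ∀ k → T (isRidge (ridgeSeq ρ w k))
      all-ridges = nthOr-All ρ-ridge (ρ-ridge ∷ ridges-isRidge w)
      stepAt : ∀ {σ} (w : Walk σ _) k → 1 ≤ k → k ≤ suc (steps w) →
        IsSimplex K (suc n) (facetSeq η w k) × ridgeSeq ρ w k ≢ ridgeSeq ρ w (suc k) ×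
        ridgeSeq ρ w k ⊆ facetSeq η w k × ridgeSeq ρ w (suc k) ⊆ facetSeq η w k
      stepAt (stop _) 1 _ _ = facet⇒IsSimplex η-facet , τ≢ρ , τ⊆η , ρ⊆η
      stepAt (step e _ e-facet _ σ⊆e σ′⊆e σ≢σ′ w) 1 _ _ =
        facet⇒IsSimplex e-facet ,
        subst (_ ≢_) (sym (ridges-head w ρ)) σ≢σ′ , σ⊆e , subst (_⊆ e) (sym (ridges-head w ρ)) σ′⊆e
      stepAt (stop _) (suc (suc k)) _ (s≤s ())
      stepAt (step _ _ _ _ _ _ _ w) (suc (suc k)) _ (s≤s k≤) = stepAt w (suc k) (s≤s z≤n) k≤

    -- The walk w from σ to σ′ closed up by the facet η is the cycle, with σ′_z := σ_z.
    cycle : ∀ {σ σ′} η → ¬ Allowed η → T (isFacet η) → σ ⊆ η → σ′ ⊆ η → σ′ ≢ σ →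
            (w : Walk σ σ′) → IsSimple w → AvoidsStart w → 2 ≤ steps w → HasCycle K (suc n)
    cycle {σ} η η∉ η-facet σ⊆η σ′⊆η σ′≢σ w@(step _ _ _ σ-ridge _ _ _ w′) (ridges-uniq , facets-uniq) avoid 2≤ =
      r , σs , ηs , walk , closes , σ-distinct , η-distinct , s≤s 2≤ , avoids ,
      (σs , shared , λ p q 2≤p p≤ 2≤q q≤ → σ-distinct p q (≤-trans (s≤s z≤n) 2≤p) p≤ (≤-trans (s≤s z≤n) 2≤q) q≤)
      where
      r = suc (steps w)
      σs = ridgeSeq σ w
      ηs = facetSeq η w
      walk : IsWalk K (suc n) r σs ηs
      walk = IsWalk-closing w σ-ridge η-facet σ′⊆η σ⊆η σ′≢σ
      closes : σs (suc r) ≡ σs 1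
      closes = nthOr-beyond σ (ridges w) (≤-reflexive (length-ridges w))
      σ-distinct : ∀ p q → 1 ≤ p → p ≤ r → 1 ≤ q → q ≤ r → p ≢ q → σs p ≢ σs q
      σ-distinct (suc p) (suc q) _ (s≤s p≤) _ (s≤s q≤) p≢q eq =
        p≢q (cong suc (nthOr-injective σ ridges-uniq (bound p≤) (bound q≤) eq))
        where
        bound : ∀ {i} → i ≤ steps w → i < List.length (ridges w)
        bound {i} i≤ = subst (i <_) (sym (length-ridges w)) (s≤s i≤)
      η-distinct : ∀ p q → 1 ≤ p → p ≤ r → 1 ≤ q → q ≤ r → p ≢ q → ηs p ≢ ηs q
      η-distinct (suc p) (suc q) _ (s≤s p≤) _ (s≤s q≤) p≢q eq =
        p≢q (cong suc (nthOr-injective-default η facets-uniq (η∉ ∘ facets-allowed w) (bound p≤) (bound q≤) eq))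
        where
        bound : ∀ {i} → i ≤ steps w → i ≤ List.length (facets w)
        bound {i} i≤ = subst (i ≤_) (sym (length-facets w)) i≤
      avoids : ∀ k → 2 ≤ k → k ≤ r ∸ 1 → ¬ σs 1 ⊆ ηs k
      avoids (suc zero) (s≤s ()) _
      avoids (suc (suc k)) _ (s≤s k<) =
        All.lookup avoid (nthOr-∈ η (facets w′) (subst (k <_) (sym (length-facets w′)) k<))
      shared : ∀ z → 2 ≤ z → z ≤ r →
        IsSimplex K n (σs z) × σs z ⊆ ηs (z ∸ 1) × σs z ⊆ ηs z × σs z ⊆ σs z
      shared (suc z) (s≤s 1≤z) z< =
        proj₁ walk (suc z) (s≤s z≤n) (m≤n⇒m≤1+n z<) ,
        proj₂ (proj₂ (proj₂ (proj₂ walk z 1≤z (≤-trans (n≤1+n z) z<)))) ,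
        proj₁ (proj₂ (proj₂ (proj₂ walk (suc z) (s≤s z≤n) z<))) ,
        λ x∈ → x∈

    two-steps : ∀ {σ σ′} η → ¬ Allowed η → T (isFacet η) → σ ⊆ η → σ′ ⊆ η → σ ≢ σ′ →
                (w : Walk σ σ′) → 2 ≤ steps w
    two-steps η _   _       _   _    σ≢σ′ (stop _) = ⊥-elim (σ≢σ′ refl)
    two-steps η η∉ η-facet σ⊆η σ′⊆η σ≢σ′ (step e e-allowed e-facet σ-ridge σ⊆e σ′⊆e _ (stop σ′-ridge)) =
      ⊥-elim (η∉ (subst Allowed e≡η e-allowed))
      where
      e≡η : e ≡ η
      e≡η = unique-common-superset n σ≢σ′ (proj₂ (ridge⇒IsSimplex σ-ridge)) (proj₂ (ridge⇒IsSimplex σ′-ridge))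
              (proj₂ (facet⇒IsSimplex e-facet)) (proj₂ (facet⇒IsSimplex η-facet)) σ⊆e σ′⊆e σ⊆η σ′⊆η
    two-steps _ _ _ _ _ _ (step _ _ _ _ _ _ _ (step _ _ _ _ _ _ _ _)) = s≤s (s≤s z≤n)

    walk-around-facet⇒cycle : ∀ {σ σ′} η → ¬ Allowed η → T (isFacet η) → σ ⊆ η → σ′ ⊆ η → σ ≢ σ′ →
                              Walk σ σ′ → HasCycle K (suc n)
    walk-around-facet⇒cycle η η∉ η-facet σ⊆η σ′⊆η σ≢σ′ w with simplify w
    ... | w′ , simple , avoid =
      cycle η η∉ η-facet σ⊆η σ′⊆η (σ≢σ′ ∘ sym) w′ simple avoid (two-steps η η∉ η-facet σ⊆η σ′⊆η σ≢σ′ w′)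

  weaken : ∀ {P Q : Subset m → Set} → (∀ {η} → P η → Q η) → ∀ {σ τ} → Walks.Walk P σ τ → Walks.Walk Q σ τ
  weaken f (Walks.stop σ-ridge)             = Walks.stop σ-ridge
  weaken f (Walks.step η a e r s s′ d w) = Walks.step η (f a) e r s s′ d (weaken f w)

  -- Merging classes of ridges

  Labelling : Set
  Labelling = Subset m → Subset m

  -- A partition of the ridges: each ridge is sent to the representative of its class.
  IsLabelling : Labelling → Set
  IsLabelling lab = ∀ {σ} → T (isRidge σ) → T (isRidge (lab σ)) × lab (lab σ) ≡ lab σ

  isRepresentative : Labelling → Subset m → Bool
  isRepresentative lab σ = isRidge σ ∧ ⌊ lab σ ≟ₛ σ ⌋

  #classes : Labelling → ℕ
  #classes lab = countB (isRepresentative lab) Faces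

  𝟙-representative : ∀ lab {σ} → T (isRidge σ) → lab σ ≡ σ → 𝟙[ isRepresentative lab σ ] ≡ 1
  𝟙-representative lab σ-ridge fixed = 𝟙-T (T-∧⁺ σ-ridge (fromWitness fixed))

  𝟙-not-representative : ∀ lab {σ} → lab σ ≢ σ → 𝟙[ isRepresentative lab σ ] ≡ 0
  𝟙-not-representative lab {σ} moved = 𝟙-¬T (moved ∘ toWitness ∘ T-∧⁻ʳ (isRidge σ))

  anchor : Subset m → Subset m
  anchor η = firstWith (isRidgeOf η) η Faces

  anchor-isRidgeOf : ∀ {η} → T (isFacet η) → T (isRidgeOf η (anchor η))
  anchor-isRidgeOf {η} η-facet with countB-witness (isRidgeOf η) Faces
                                      (subst (0 <_) (sym (#ridgesOf-facet η-facet)) (s≤s z≤n))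
  ... | σ , σ∈ , σ-ridge = firstWith-satisfies (isRidgeOf η) η σ∈ σ-ridge

  isLabelOn : Labelling → Subset m → Subset m → Bool
  isLabelOn lab η = IsImage (isRidgeOf η) lab Faces

  merge : Subset m → Labelling → Labelling
  merge η lab σ = if isLabelOn lab η (lab σ) then lab (anchor η) else lab σ

  mergeAll : List (Subset m) → Labelling → Labelling
  mergeAll []       lab = lab
  mergeAll (η ∷ ηs) lab = mergeAll ηs (if isFacet η then merge η lab else lab)

  module Merge {lab : Labelling} (lab-ok : IsLabelling lab) {η} (η-facet : T (isFacet η)) where

    root : Subset m
    root = lab (anchor η)

    root-isLabelOn : T (isLabelOn lab η root)
    root-isLabelOn = IsImage-complete {p = isRidgeOf η} {g = lab} (allSubsets-complete (anchor η)) (anchor-isRidgeOf η-facet)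

    isLabelOn⇒representative : ∀ {ρ} → T (isLabelOn lab η ρ) → T (isRidge ρ) × lab ρ ≡ ρ
    isLabelOn⇒representative h with IsImage-sound {p = isRidgeOf η} {g = lab} {L = Faces} h
    ... | σ , _ , σ-ridge , refl = lab-ok (isRidgeOf⇒isRidge σ-ridge)

    merge-hit : ∀ {σ} → T (isLabelOn lab η (lab σ)) → merge η lab σ ≡ root
    merge-hit = if-T

    merge-miss : ∀ {σ} → ¬ T (isLabelOn lab η (lab σ)) → merge η lab σ ≡ lab σ
    merge-miss = if-¬T

    root-representative : T (isRidge root) × lab root ≡ root
    root-representative = isLabelOn⇒representative root-isLabelOn

    merge-root : merge η lab root ≡ root
    merge-root = merge-hit (subst (T ∘ isLabelOn lab η) (sym (proj₂ root-representative)) root-isLabelOn)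

    merge-IsLabelling : IsLabelling (merge η lab)
    merge-IsLabelling {σ} σ-ridge with T? (isLabelOn lab η (lab σ))
    ... | yes hit rewrite merge-hit hit = proj₁ root-representative , merge-root
    ... | no miss rewrite merge-miss miss =
      proj₁ (lab-ok σ-ridge) ,
      trans (merge-miss (miss ∘ subst (T ∘ isLabelOn lab η) (proj₂ (lab-ok σ-ridge)))) (proj₂ (lab-ok σ-ridge))

    #labelsOn : ℕ
    #labelsOn = countB (isLabelOn lab η) Faces

    private
      root-isRidge : T (isRidge root)
      root-isRidge = proj₁ root-representative

      root≢moved : ∀ {σ} → lab σ ≢ σ → root ≢ σ
      root≢moved moved refl = moved (proj₂ root-representative)

      merge-moved : ∀ {σ} → lab σ ≢ σ → merge η lab σ ≢ σ
      merge-moved {σ} moved with T? (isLabelOn lab η (lab σ))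
      ... | yes hit = subst (_≢ σ) (sym (merge-hit hit)) (root≢moved moved)
      ... | no miss = subst (_≢ σ) (sym (merge-miss miss)) moved

      𝟙-≟ₛ : ∀ {ρ σ : Subset m} → ρ ≢ σ → 𝟙[ ⌊ ρ ≟ₛ σ ⌋ ] ≡ 0
      𝟙-≟ₛ ρ≢σ = 𝟙-¬T (ρ≢σ ∘ toWitness)

      -- Only representatives hit by η change status: they all merge into the root.
      pointwise : ∀ σ → 𝟙[ isRepresentative (merge η lab) σ ] + 𝟙[ isLabelOn lab η σ ]
                        ≡ 𝟙[ isRepresentative lab σ ] + 𝟙[ ⌊ root ≟ₛ σ ⌋ ]
      pointwise σ with T? (isRidge σ)
      ... | no ¬ridge =
        trans (cong₂ _+_ (𝟙-¬T (¬ridge ∘ T-∧⁻ˡ (isRidge σ))) (𝟙-¬T (¬ridge ∘ proj₁ ∘ isLabelOn⇒representative)))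
              (sym (cong₂ _+_ (𝟙-¬T (¬ridge ∘ T-∧⁻ˡ (isRidge σ)))
                              (𝟙-¬T λ t → ¬ridge (subst (T ∘ isRidge) (toWitness t) root-isRidge))))
      ... | yes ridge with lab σ ≟ₛ σ
      ...   | no moved =
        trans (cong₂ _+_ (𝟙-not-representative (merge η lab) (merge-moved moved))
                         (𝟙-¬T (moved ∘ proj₂ ∘ isLabelOn⇒representative)))
              (sym (cong₂ _+_ (𝟙-¬T (T-∧⁻ʳ (isRidge σ))) (𝟙-≟ₛ (root≢moved moved))))
      ...   | yes fixed with T? (isLabelOn lab η σ)
      ...     | no miss =
        trans (cong₂ _+_ (𝟙-representative (merge η lab) ridge (trans (merge-miss miss′) fixed)) (𝟙-¬T miss))
              (sym (cong₂ _+_ (𝟙-T (T-∧⁺ ridge _))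
                              (𝟙-≟ₛ λ root≡σ → miss (subst (T ∘ isLabelOn lab η) root≡σ root-isLabelOn))))
        where miss′ = miss ∘ subst (T ∘ isLabelOn lab η) fixed
      ...     | yes hit with root ≟ₛ σ
      ...       | yes root≡σ =
        trans (cong₂ _+_ (𝟙-representative (merge η lab) ridge (trans (merge-hit hit′) root≡σ)) (𝟙-T hit))
              (sym (cong (_+ 1) (𝟙-T (T-∧⁺ ridge _))))
        where hit′ = subst (T ∘ isLabelOn lab η) (sym fixed) hit
      ...       | no root≢σ =
        trans (cong₂ _+_ (𝟙-not-representative (merge η lab) (λ eq → root≢σ (trans (sym (merge-hit hit′)) eq)))
                         (𝟙-T hit))
              (sym (cong (_+ 0) (𝟙-T (T-∧⁺ ridge _))))
        where hit′ = subst (T ∘ isLabelOn lab η) (sym fixed) hit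

    #classes-merge : #classes (merge η lab) + #labelsOn ≡ #classes lab + 1
    #classes-merge = trans (countB-pointwise _ _ _ _ Faces pointwise) (cong (#classes lab +_) (count-≟ root))

    #labelsOn≤ : #labelsOn ≤ suc (suc n)
    #labelsOn≤ = subst (#labelsOn ≤_) (#ridgesOf-facet η-facet) (count-image≤ (isRidgeOf η) lab Faces)

    #labelsOn≡ : (∀ {σ σ′} → T (isRidgeOf η σ) → T (isRidgeOf η σ′) → lab σ ≡ lab σ′ → σ ≡ σ′) →
                 #labelsOn ≡ suc (suc n)
    #labelsOn≡ injective = trans (count-image≡ (isRidgeOf η) lab Faces (allSubsets-unique m) (λ _ _ → injective))
                                 (#ridgesOf-facet η-facet)

    merge-glues : ∀ {σ σ′} → T (isRidgeOf η σ) → T (isRidgeOf η σ′) → merge η lab σ ≡ merge η lab σ′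
    merge-glues {σ} {σ′} σ∈η σ′∈η = trans (merge-hit (hit σ∈η)) (sym (merge-hit (hit σ′∈η)))
      where
      hit : ∀ {ρ} → T (isRidgeOf η ρ) → T (isLabelOn lab η (lab ρ))
      hit {ρ} = IsImage-complete {p = isRidgeOf η} {g = lab} (allSubsets-complete ρ)

    merge-cong : ∀ {σ σ′} → lab σ ≡ lab σ′ → merge η lab σ ≡ merge η lab σ′
    merge-cong = cong λ ρ → if isLabelOn lab η ρ then root else ρ

    merge-identifies : ∀ {σ σ′} → merge η lab σ ≡ merge η lab σ′ →
      lab σ ≡ lab σ′ ⊎ (T (isLabelOn lab η (lab σ)) × T (isLabelOn lab η (lab σ′)))
    merge-identifies {σ} {σ′} eq with T? (isLabelOn lab η (lab σ)) | T? (isLabelOn lab η (lab σ′))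
    ... | yes hit | yes hit′ = inj₂ (hit , hit′)
    ... | no miss | no miss′ = inj₁ (trans (sym (merge-miss miss)) (trans eq (merge-miss miss′)))
    ... | yes hit | no miss′ =
      ⊥-elim (miss′ (subst (T ∘ isLabelOn lab η) (trans (sym (merge-hit hit)) (trans eq (merge-miss miss′))) root-isLabelOn))
    ... | no miss | yes hit′ =
      ⊥-elim (miss (subst (T ∘ isLabelOn lab η) (trans (sym (merge-hit hit′)) (trans (sym eq) (merge-miss miss))) root-isLabelOn))

  mergeAll-facet : ∀ {η} ηs lab → T (isFacet η) → mergeAll (η ∷ ηs) lab ≡ mergeAll ηs (merge η lab)
  mergeAll-facet ηs lab η-facet = cong (mergeAll ηs) (if-T η-facet)

  mergeAll-other : ∀ {η} ηs lab → ¬ T (isFacet η) → mergeAll (η ∷ ηs) lab ≡ mergeAll ηs lab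
  mergeAll-other ηs lab ¬facet = cong (mergeAll ηs) (if-¬T ¬facet)

  #facets-∷-facet : ∀ {η} ηs → T (isFacet η) → countB isFacet (η ∷ ηs) ≡ suc (countB isFacet ηs)
  #facets-∷-facet {η} ηs η-facet = trans (countB-cons isFacet η ηs) (cong (_+ countB isFacet ηs) (𝟙-T η-facet))

  #facets-∷-other : ∀ {η} ηs → ¬ T (isFacet η) → countB isFacet (η ∷ ηs) ≡ countB isFacet ηs
  #facets-∷-other {η} ηs ¬facet = trans (countB-cons isFacet η ηs) (cong (_+ countB isFacet ηs) (𝟙-¬T ¬facet))

  mergeAll-IsLabelling : ∀ ηs {lab} → IsLabelling lab → IsLabelling (mergeAll ηs lab)
  mergeAll-IsLabelling []       lab-ok = lab-ok
  mergeAll-IsLabelling (η ∷ ηs) {lab} lab-ok with T? (isFacet η)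
  ... | yes η-facet = subst IsLabelling (sym (mergeAll-facet ηs lab η-facet))
                        (mergeAll-IsLabelling ηs (Merge.merge-IsLabelling lab-ok η-facet))
  ... | no ¬facet   = subst IsLabelling (sym (mergeAll-other ηs lab ¬facet)) (mergeAll-IsLabelling ηs lab-ok)

  MergedExcept : List (Subset m) → Labelling → Set
  MergedExcept ηs lab = ∀ {η} → T (isFacet η) → η ∉ ηs →
                        ∀ {σ σ′} → T (isRidgeOf η σ) → T (isRidgeOf η σ′) → lab σ ≡ lab σ′

  mergeAll-merges : ∀ ηs {lab} → IsLabelling lab → MergedExcept ηs lab → MergedExcept [] (mergeAll ηs lab)
  mergeAll-merges []       _      merged = merged
  mergeAll-merges (η ∷ ηs) {lab} lab-ok merged with T? (isFacet η)
  ... | yes η-facet = subst (MergedExcept []) (sym (mergeAll-facet ηs lab η-facet))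
                        (mergeAll-merges ηs merge-IsLabelling merged′)
    where
    open Merge lab-ok η-facet
    merged′ : MergedExcept ηs (merge η lab)
    merged′ {η′} η′-facet η′∉ηs σ∈η′ σ′∈η′ with η′ ≟ₛ η
    ... | yes refl  = merge-glues σ∈η′ σ′∈η′
    ... | no  η′≢η = merge-cong (merged η′-facet (λ { (here eq) → η′≢η eq ; (there p) → η′∉ηs p }) σ∈η′ σ′∈η′)
  ... | no ¬facet = subst (MergedExcept []) (sym (mergeAll-other ηs lab ¬facet))
                      (mergeAll-merges ηs lab-ok λ η′-facet η′∉ηs →
                        merged η′-facet λ { (here refl) → ¬facet η′-facet ; (there p) → η′∉ηs p })

  #classes-mergeAll≤ : ∀ ηs {lab} → IsLabelling lab →
    #classes lab ≤ #classes (mergeAll ηs lab) + suc n * countB isFacet ηs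
  #classes-mergeAll≤ [] {lab} _ = ≤-reflexive (sym (trans (cong (#classes lab +_) (*-zeroʳ n)) (+-identityʳ _)))
  #classes-mergeAll≤ (η ∷ ηs) {lab} lab-ok with T? (isFacet η)
  ... | yes η-facet
    rewrite mergeAll-facet ηs lab η-facet | #facets-∷-facet ηs η-facet =
      +-cancelʳ-≤ 1 _ _ (begin
        #classes lab + 1                                         ≡⟨ #classes-merge ⟨
        #classes (merge η lab) + #labelsOn                       ≤⟨ +-mono-≤ (#classes-mergeAll≤ ηs merge-IsLabelling) #labelsOn≤ ⟩
        #classes final + suc n * countB isFacet ηs + suc (suc n) ≡⟨ solve (#classes final) (suc n) (countB isFacet ηs) ⟩
        #classes final + suc n * suc (countB isFacet ηs) + 1     ∎)
    where
    open Merge lab-ok η-facet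
    open ≤-Reasoning
    final = mergeAll ηs (merge η lab)
    solve : ∀ f d k → f + d * k + suc d ≡ f + d * suc k + 1
    solve = solve-∀
  ... | no ¬facet
    rewrite mergeAll-other ηs lab ¬facet | #facets-∷-other ηs ¬facet = #classes-mergeAll≤ ηs lab-ok

  ClassesConnected : List (Subset m) → Labelling → Set
  ClassesConnected ηs lab = ∀ {σ σ′} → T (isRidge σ) → T (isRidge σ′) → lab σ ≡ lab σ′ →
                            Walks.Walk (_∉ ηs) σ σ′

  module _ {lab : Labelling} (lab-ok : IsLabelling lab) {η ηs} (η-facet : T (isFacet η))
           (connected : ClassesConnected (η ∷ ηs) lab) where
    open Merge lab-ok η-facet
    open Walks (_∉ ηs) using (Walk; stop; step; _++ᵂ_)

    merge-connected : η ∉ ηs → ClassesConnected ηs (merge η lab)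
    merge-connected η∉ηs σ-ridge σ′-ridge eq with merge-identifies eq
    ... | inj₁ same = weaken (_∘ there) (connected σ-ridge σ′-ridge same)
    ... | inj₂ (hit , hit′)
      with IsImage-sound {p = isRidgeOf η} {g = lab} {L = Faces} hit
         | IsImage-sound {p = isRidgeOf η} {g = lab} {L = Faces} hit′
    ...   | ρ , _ , ρ∈η , labρ | ρ′ , _ , ρ′∈η , labρ′ =
      weaken (_∘ there) (connected σ-ridge ρ-ridge (sym labρ)) ++ᵂ
      (across ++ᵂ weaken (_∘ there) (connected ρ′-ridge σ′-ridge labρ′))
      where
      ρ-ridge = isRidgeOf⇒isRidge ρ∈η
      ρ′-ridge = isRidgeOf⇒isRidge ρ′∈η
      across : Walk ρ ρ′
      across with ρ ≟ₛ ρ′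
      ... | yes refl = stop ρ-ridge
      ... | no ρ≢ρ′ = step η η∉ηs η-facet ρ-ridge (isRidgeOf⇒⊆ ρ∈η) (isRidgeOf⇒⊆ ρ′∈η) ρ≢ρ′ (stop ρ′-ridge)

    acyclic⇒injective : ¬ HasCycle K (suc n) →
      ∀ {σ σ′} → T (isRidgeOf η σ) → T (isRidgeOf η σ′) → lab σ ≡ lab σ′ → σ ≡ σ′
    acyclic⇒injective acyclic {σ} {σ′} σ∈η σ′∈η eq with σ ≟ₛ σ′
    ... | yes σ≡σ′ = σ≡σ′
    ... | no σ≢σ′ = ⊥-elim (acyclic (Walks.walk-around-facet⇒cycle (_∉ η ∷ ηs) η (λ η∉ → η∉ (here refl)) η-facet
                      (isRidgeOf⇒⊆ σ∈η) (isRidgeOf⇒⊆ σ′∈η) σ≢σ′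
                      (connected (isRidgeOf⇒isRidge σ∈η) (isRidgeOf⇒isRidge σ′∈η) eq)))

  #classes-mergeAll-acyclic : ¬ HasCycle K (suc n) → ∀ ηs {lab} → Unique ηs → IsLabelling lab →
    ClassesConnected ηs lab → #classes (mergeAll ηs lab) + suc n * countB isFacet ηs ≡ #classes lab
  #classes-mergeAll-acyclic acyclic [] {lab} _ _ _ = trans (cong (#classes lab +_) (*-zeroʳ n)) (+-identityʳ _)
  #classes-mergeAll-acyclic acyclic (η ∷ ηs) {lab} (η∉ηs ∷ unique) lab-ok connected with T? (isFacet η)
  ... | yes η-facet
    rewrite mergeAll-facet ηs lab η-facet | #facets-∷-facet ηs η-facet =
      +-cancelʳ-≡ 1 _ _ (begin
        #classes final + suc n * suc (countB isFacet ηs) + 1 ≡⟨ solve (#classes final) (suc n) (countB isFacet ηs) ⟩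
        #classes final + suc n * countB isFacet ηs + suc (suc n)
          ≡⟨ cong₂ _+_ (#classes-mergeAll-acyclic acyclic ηs unique merge-IsLabelling
                          (merge-connected lab-ok η-facet connected (All¬⇒¬Any η∉ηs)))
                       (sym (#labelsOn≡ (acyclic⇒injective lab-ok η-facet connected acyclic))) ⟩
        #classes (merge η lab) + #labelsOn                   ≡⟨ #classes-merge ⟩
        #classes lab + 1                                     ∎)
    where
    open Merge lab-ok η-facet
    open ≡-Reasoning
    final = mergeAll ηs (merge η lab)
    solve : ∀ f d k → f + d * suc k + 1 ≡ f + d * k + suc d
    solve = solve-∀
  ... | no ¬facet
    rewrite mergeAll-other ηs lab ¬facet | #facets-∷-other ηs ¬facet =
      #classes-mergeAll-acyclic acyclic ηs unique lab-ok λ σ-ridge σ′-ridge eq →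
        weaken (_∘ there) (connected σ-ridge σ′-ridge eq)

  id-IsLabelling : IsLabelling id
  id-IsLabelling σ-ridge = σ-ridge , refl

  #classes-id : #classes id ≡ α n K
  #classes-id = countB-cong _ _ Faces λ σ → every-ridge-represents-itself σ
    where
    every-ridge-represents-itself : ∀ σ → isRidge σ ∧ ⌊ σ ≟ₛ σ ⌋ ≡ isRidge σ
    every-ridge-represents-itself σ with σ ≟ₛ σ
    ... | yes _     = Bool.∧-identityʳ (isRidge σ)
    ... | no  σ≢σ = ⊥-elim (σ≢σ refl)

  #classes≥1 : ∀ {lab} → IsLabelling lab → ∀ {σ} → T (isRidge σ) → 1 ≤ #classes lab
  #classes≥1 {lab} lab-ok {σ} σ-ridge = countB-≥1 (isRepresentative lab) (allSubsets-complete (lab σ))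
    (T-∧⁺ (proj₁ (lab-ok σ-ridge)) (fromWitness (proj₂ (lab-ok σ-ridge))))

  #classes≤1 : ∀ {lab} → (∀ {σ σ′} → T (isRidge σ) → T (isRidge σ′) → lab σ ≡ lab σ′) → #classes lab ≤ 1
  #classes≤1 {lab} one-class = count-≤1 (isRepresentative lab) λ σ σ′ σ-rep σ′-rep →
    trans (sym (toWitness (T-∧⁻ʳ (isRidge σ) σ-rep)))
          (trans (one-class (T-∧⁻ˡ (isRidge σ) σ-rep) (T-∧⁻ˡ (isRidge σ′) σ′-rep))
                 (toWitness (T-∧⁻ʳ (isRidge σ′) σ′-rep)))

  merged-label-along-walk : ∀ {lab} → MergedExcept [] lab → ∀ {r σ η} → IsWalk K (suc n) r σ η →
                            ∀ k → k ≤ r → lab (σ (suc k)) ≡ lab (σ 1)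
  merged-label-along-walk merged walk zero _ = refl
  merged-label-along-walk merged {r} {σ} walk (suc k) k<r with proj₂ walk (suc k) (s≤s z≤n) k<r
  ... | η-simplex , _ , σₖ⊆η , σₖ₊₁⊆η =
    trans (sym (merged (IsSimplex⇒facet η-simplex) (λ ())
                       (isRidgeOf-intro (ridge (suc k) (s≤s z≤n) (m≤n⇒m≤1+n k<r)) σₖ⊆η)
                       (isRidgeOf-intro (ridge (suc (suc k)) (s≤s z≤n) (s≤s k<r)) σₖ₊₁⊆η)))
          (merged-label-along-walk merged walk k (≤-trans (n≤1+n k) k<r))
    where
    ridge : ∀ j → 1 ≤ j → j ≤ suc r → T (isRidge (σ j))
    ridge j 1≤j j≤ = IsSimplex⇒ridge (proj₁ walk j 1≤j j≤)

  acyclic⇒lower-bound : ¬ HasCycle K (suc n) → ∀ {η} → IsSimplex K (suc n) η →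
                        suc n * α (suc n) K + 1 ≤ α n K
  acyclic⇒lower-bound acyclic η-simplex = begin
    suc n * α (suc n) K + 1                  ≤⟨ +-monoʳ-≤ _ (#classes≥1 final-ok (anchor-isRidge)) ⟩
    suc n * α (suc n) K + #classes final     ≡⟨ +-comm _ (#classes final) ⟩
    #classes final + suc n * α (suc n) K     ≡⟨ #classes-mergeAll-acyclic acyclic Faces (allSubsets-unique m)
                                                  id-IsLabelling (λ σ-ridge _ → λ { refl → Walks.stop σ-ridge }) ⟩
    #classes id                              ≡⟨ #classes-id ⟩
    α n K                                    ∎
    where
    open ≤-Reasoning
    final = mergeAll Faces id
    final-ok = mergeAll-IsLabelling Faces id-IsLabelling
    anchor-isRidge = isRidgeOf⇒isRidge (anchor-isRidgeOf (IsSimplex⇒facet η-simplex))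

  connected⇒upper-bound : IsConnected K (suc n) → α n K ≤ suc n * α (suc n) K + 1
  connected⇒upper-bound connected = begin
    α n K                                    ≡⟨ #classes-id ⟨
    #classes id                              ≤⟨ #classes-mergeAll≤ Faces id-IsLabelling ⟩
    #classes final + suc n * α (suc n) K     ≤⟨ +-monoˡ-≤ _ (#classes≤1 one-class) ⟩
    1 + suc n * α (suc n) K                  ≡⟨ +-comm 1 _ ⟩
    suc n * α (suc n) K + 1                  ∎
    where
    open ≤-Reasoning
    final = mergeAll Faces id
    merged : MergedExcept [] final
    merged = mergeAll-merges Faces id-IsLabelling λ _ η∉ → ⊥-elim (η∉ (allSubsets-complete _))
    one-class : ∀ {σ σ′} → T (isRidge σ) → T (isRidge σ′) → final σ ≡ final σ′
    one-class {σ} {σ′} σ-ridge σ′-ridge with σ ≟ₛ σ′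
    ... | yes refl = refl
    ... | no σ≢σ′ with connected σ σ′ (ridge⇒IsSimplex σ-ridge) (ridge⇒IsSimplex σ′-ridge) σ≢σ′
    ...   | r , σs , ηs , (walk , _) , refl , refl = sym (merged-label-along-walk merged walk r ≤-refl)

lemma5p3 : ∀ {m : ℕ} (n : ℕ) (K : SimplicialComplex m) → 1 ≤ n → IsPure K n →
    (¬ HasCycle K n → n * α n K + 1 ≤ α (n ∸ 1) K)
    × (IsConnected K n → α (n ∸ 1) K ≤ n * α n K + 1)
lemma5p3 zero    K ()
lemma5p3 (suc n) K _ (((_ , η-simplex) , _) , _) =
  (λ acyclic → acyclic⇒lower-bound acyclic η-simplex) , connected⇒upper-bound
  where open Complex K n
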